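{- Let $n\ge 3$ and $m\ge 2$ be integers and consider the cycle-based self-similar graphs $G^{(i)}=G^{(i,m,n)}$ defined in the context. For $k\ge 0$ let $|V^{(k)}|$ and $|E^{(k)}|$ denote the number of vertices and edges of $G^{(k-1)}$, where $G^{(-1)}$ is a single vertex (so $|V^{(0)}|=1$, $|E^{(0)}|=0$, $|V^{(1)}|=|E^{(1)}|=n$). Then for all $i\ge 1$, $$|V^{(i)}|=n|V^{(i-1)}|+(m-1)|E^{(i-1)}|,\qquad |E^{(i)}|=n|V^{(i-1)}|+m|E^{(i-1)}|,$$ and for all $i\ge 2$, $$|V^{(i)}|=(n+m)|V^{(i-1)}|-n|V^{(i-2)}|,\qquad |E^{(i)}|=(n+m)|E^{(i-1)}|-n|E^{(i-2)}|.$$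
   Context: The edge-path transformation replaces every edge of a graph by a path of length $m$ (inserting $m-1$ new internal vertices on each edge). The cycle-based model: $G^{(0)}=C_n$, and for $i\ge 0$, $G^{(i+1)}$ is obtained from $G^{(i)}$ by first applying the edge-path transformation, and then, for every vertex $v$ of $G^{(i)}$ (i.e. every vertex present before the subdivision), attaching a new copy of $C_n$ by identifying $v$ with one vertex of that copy. -}

module Defs where

open import Data.Nat using (ℕ; zero; suc; _+_; _*_; _∸_)
open import Data.List using (List; []; _∷_; map; upTo; length; _++_)
open import Data.Product using (_×_; _,_)

-- A finite (multi)graph: vertices are labelled 0 , 1 , … , nV - 1;
-- the edge list contains every edge exactly once (as an ordered pair of endpoints).
record Graph : Set where
  constructor graph
  field
    nV    : ℕ
    edges : List (ℕ × ℕ)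
open Graph public

∣V∣ : Graph → ℕ
∣V∣ = nV

∣E∣ : Graph → ℕ
∣E∣ G = length (edges G)

chain : ℕ → List ℕ → ℕ → List (ℕ × ℕ)
chain u []       v = (u , v) ∷ []
chain u (w ∷ ws) v = (u , w) ∷ chain w ws v

block : ℕ → ℕ → List ℕ
block b k = map (b +_) (upTo k)

cycleGraph : ℕ → Graph
cycleGraph zero    = graph 0 []
cycleGraph (suc k) = graph (suc k) (chain 0 (block 1 k) 0)

-- Edge-path transformation with paths of length m: the j-th edge (u,v)
-- (j = 0,1,…) is replaced by the path u — b+j(m-1) — … — b+j(m-1)+(m-2) — v,
-- where b is the number of old vertices (fresh labels for the m-1 internal vertices).
subdivEdges : ℕ → ℕ → ℕ → List (ℕ × ℕ) → List (ℕ × ℕ)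
subdivEdges m b j []             = []
subdivEdges m b j ((u , v) ∷ es) =
  chain u (block (b + j * (m ∸ 1)) (m ∸ 1)) v ++ subdivEdges m b (suc j) es

edgePath : ℕ → Graph → Graph
edgePath m G =
  graph (nV G + ∣E∣ G * (m ∸ 1)) (subdivEdges m (nV G) 0 (edges G))

-- Attach a new copy of C_n at every vertex v < k of H, by identifying v with a
-- vertex of the copy: new vertices b+v(n-1), …, b+v(n-1)+(n-2) with the cycle
-- v — (new vertices) — v  (b = number of vertices of H).
attachEdges : ℕ → ℕ → ℕ → List (ℕ × ℕ)
attachEdges n b zero    = []
attachEdges n b (suc v) =
  attachEdges n b v ++ chain v (block (b + v * (n ∸ 1)) (n ∸ 1)) v

attachCycles : ℕ → ℕ → Graph → Graph
attachCycles n k H =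
  graph (nV H + k * (n ∸ 1)) (edges H ++ attachEdges n (nV H) k)

-- The vertices of G^(i) keep their labels 0 … |V(G^(i))|-1 after the
-- edge-path transformation, so "vertices of G^(i)" are exactly those labels.
G : (m n : ℕ) → ℕ → Graph
G m n zero    = cycleGraph n
G m n (suc i) = attachCycles n (nV (G m n i)) (edgePath m (G m n i))

Vk : (m n : ℕ) → ℕ → ℕ
Vk m n zero    = 1
Vk m n (suc k) = ∣V∣ (G m n k)

Ek : (m n : ℕ) → ℕ → ℕ
Ek m n zero    = 0
Ek m n (suc k) = ∣E∣ (G m n k)

{-# OPTIONS --safe #-}
-- One generation replaces each edge by m edges through m - 1 new vertices and
-- hangs a cycle with n edges and n - 1 new vertices on every old vertex, so
-- (|V|, |E|) evolves by the matrix ((n, m - 1), (n, m)); G^(-1) being a single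
-- vertex makes this hold from i = 0 on.  That matrix has trace n + m and
-- determinant n, so by Cayley–Hamilton both coordinates satisfy
-- x(i+2) = (n + m) x(i+1) - n x(i), stated with the subtraction moved left.
module Submission where

open import Defs
open import Data.Nat using (ℕ; zero; suc; _+_; _*_; _∸_; _≤_; s≤s; NonZero)
open import Data.Nat.Properties using (+-comm; *-comm; *-suc; *-distribʳ-+; suc-pred)
open import Data.Nat.Tactic.RingSolver using (solve-∀)
open import Data.List using ([]; _∷_; length; _++_; upTo)
open import Data.List.Properties using (length-++; length-map; length-upTo)
open import Data.Product using (_×_; _,_)
open import Relation.Binary.PropositionalEquality
  using (_≡_; refl; sym; trans; cong; cong₂; module ≡-Reasoning)
open ≡-Reasoning

length-chain : ∀ u ws v → length (chain u ws v) ≡ suc (length ws)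
length-chain u []       v = refl
length-chain u (w ∷ ws) v = cong suc (length-chain w ws v)

length-block : ∀ b k → length (block b k) ≡ k
length-block b k = trans (length-map (b +_) (upTo k)) (length-upTo k)

length-chain-block : ∀ u b k v → length (chain u (block b k) v) ≡ suc k
length-chain-block u b k v = trans (length-chain u (block b k) v) (cong suc (length-block b k))

length-subdivEdges : ∀ m b j es →
  length (subdivEdges m b j es) ≡ length es * suc (m ∸ 1)
length-subdivEdges m b j []             = refl
length-subdivEdges m b j ((u , v) ∷ es) = begin
  length (path ++ rest)       ≡⟨ length-++ path ⟩
  length path + length rest   ≡⟨ cong₂ _+_ (length-chain-block u _ (m ∸ 1) v)
                                           (length-subdivEdges m b (suc j) es) ⟩
  suc (m ∸ 1) + length es * suc (m ∸ 1) ∎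
  where
  path = chain u (block (b + j * (m ∸ 1)) (m ∸ 1)) v
  rest = subdivEdges m b (suc j) es

length-attachEdges : ∀ n b k → length (attachEdges n b k) ≡ k * suc (n ∸ 1)
length-attachEdges n b zero    = refl
length-attachEdges n b (suc v) = begin
  length (rest ++ cycle)       ≡⟨ length-++ rest ⟩
  length rest + length cycle   ≡⟨ cong₂ _+_ (length-attachEdges n b v)
                                            (length-chain-block v _ (n ∸ 1) v) ⟩
  v * suc (n ∸ 1) + suc (n ∸ 1) ≡⟨ +-comm (v * suc (n ∸ 1)) _ ⟩
  suc (n ∸ 1) + v * suc (n ∸ 1) ∎
  where
  rest  = attachEdges n b v
  cycle = chain v (block (b + v * (n ∸ 1)) (n ∸ 1)) v

∣V∣-cycleGraph : ∀ n → ∣V∣ (cycleGraph n) ≡ n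
∣V∣-cycleGraph zero    = refl
∣V∣-cycleGraph (suc n) = refl

∣E∣-cycleGraph : ∀ n → ∣E∣ (cycleGraph n) ≡ n
∣E∣-cycleGraph zero    = refl
∣E∣-cycleGraph (suc n) = length-chain-block 0 1 n 0

∣E∣-edgePath : ∀ m H → .{{NonZero m}} → ∣E∣ (edgePath m H) ≡ ∣E∣ H * m
∣E∣-edgePath m H = trans (length-subdivEdges m (nV H) 0 (edges H))
                         (cong (∣E∣ H *_) (suc-pred m))

∣E∣-attachCycles : ∀ n k H → .{{NonZero n}} →
  ∣E∣ (attachCycles n k H) ≡ ∣E∣ H + k * n
∣E∣-attachCycles n k H = begin
  length (edges H ++ attachEdges n (nV H) k)  ≡⟨ length-++ (edges H) ⟩
  ∣E∣ H + length (attachEdges n (nV H) k)     ≡⟨ cong (∣E∣ H +_) (length-attachEdges n (nV H) k) ⟩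
  ∣E∣ H + k * suc (n ∸ 1)                     ≡⟨ cong (λ t → ∣E∣ H + k * t) (suc-pred n) ⟩
  ∣E∣ H + k * n                               ∎

n≡n*1+k*0 : ∀ n k → n ≡ n * 1 + k * 0
n≡n*1+k*0 = solve-∀

Vk-suc : ∀ m n → .{{NonZero n}} → ∀ i →
  Vk m n (suc i) ≡ n * Vk m n i + (m ∸ 1) * Ek m n i
Vk-suc m n       zero    = trans (∣V∣-cycleGraph n) (n≡n*1+k*0 n (m ∸ 1))
Vk-suc m (suc n) (suc i) = count (∣V∣ H) (∣E∣ H) n (m ∸ 1)
  where
  H = G m (suc n) i
  count : ∀ V E n k → V + E * k + V * n ≡ suc n * V + k * E
  count = solve-∀

Ek-suc : ∀ m n → .{{NonZero m}} → .{{NonZero n}} → ∀ i →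
  Ek m n (suc i) ≡ n * Vk m n i + m * Ek m n i
Ek-suc m n zero    = trans (∣E∣-cycleGraph n) (n≡n*1+k*0 n m)
Ek-suc m n (suc i) = begin
  ∣E∣ (attachCycles n V (edgePath m H))  ≡⟨ ∣E∣-attachCycles n V (edgePath m H) ⟩
  ∣E∣ (edgePath m H) + V * n             ≡⟨ cong (_+ V * n) (∣E∣-edgePath m H) ⟩
  E * m + V * n                          ≡⟨ count V E n m ⟩
  n * V + m * E                          ∎
  where
  H = G m n i
  V = ∣V∣ H
  E = ∣E∣ H
  count : ∀ V E n m → E * m + V * n ≡ n * V + m * E
  count = solve-∀

cayley-hamiltonˡ : ∀ a b c d δ (x y : ℕ → ℕ) → a * d ≡ b * c + δ →
  (∀ i → x (suc i) ≡ a * x i + b * y i) →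
  (∀ i → y (suc i) ≡ c * x i + d * y i) →
  ∀ i → x (suc (suc i)) + δ * x i ≡ (a + d) * x (suc i)
cayley-hamiltonˡ a b c d δ x y det x-suc y-suc i = begin
  x (suc (suc i)) + δ * X               ≡⟨ cong (_+ δ * X) (x-suc (suc i)) ⟩
  a * X′ + b * y (suc i) + δ * X        ≡⟨ cong (λ t → a * X′ + b * t + δ * X) (y-suc i) ⟩
  a * X′ + b * (c * X + d * Y) + δ * X  ≡⟨ collect a b c d δ X Y X′ ⟩
  a * X′ + (b * c + δ) * X + b * d * Y  ≡⟨ cong (λ t → a * X′ + t * X + b * d * Y) (sym det) ⟩
  a * X′ + a * d * X + b * d * Y        ≡⟨ factor a b d X Y X′ ⟩
  a * X′ + d * (a * X + b * Y)          ≡⟨ cong (λ t → a * X′ + d * t) (sym (x-suc i)) ⟩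
  a * X′ + d * X′                       ≡⟨ sym (*-distribʳ-+ X′ a d) ⟩
  (a + d) * X′                          ∎
  where
  X  = x i
  Y  = y i
  X′ = x (suc i)
  collect : ∀ a b c d δ X Y X′ →
    a * X′ + b * (c * X + d * Y) + δ * X ≡ a * X′ + (b * c + δ) * X + b * d * Y
  collect = solve-∀
  factor : ∀ a b d X Y X′ →
    a * X′ + a * d * X + b * d * Y ≡ a * X′ + d * (a * X + b * Y)
  factor = solve-∀

cayley-hamilton : ∀ a b c d δ (x y : ℕ → ℕ) → a * d ≡ b * c + δ →
  (∀ i → x (suc i) ≡ a * x i + b * y i) →
  (∀ i → y (suc i) ≡ c * x i + d * y i) →
  ∀ i → (x (suc (suc i)) + δ * x i ≡ (a + d) * x (suc i))
      × (y (suc (suc i)) + δ * y i ≡ (a + d) * y (suc i))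
cayley-hamilton a b c d δ x y det x-suc y-suc i =
  cayley-hamiltonˡ a b c d δ x y det x-suc y-suc i ,
  (begin
    y (suc (suc i)) + δ * y i  ≡⟨ cayley-hamiltonˡ d c b a δ y x det′ y-suc′ x-suc′ i ⟩
    (d + a) * y (suc i)        ≡⟨ cong (_* y (suc i)) (+-comm d a) ⟩
    (a + d) * y (suc i)        ∎)
  where
  det′ : d * a ≡ c * b + δ
  det′ = trans (*-comm d a) (trans det (cong (_+ δ) (*-comm b c)))
  x-suc′ : ∀ i → x (suc i) ≡ b * y i + a * x i
  x-suc′ i = trans (x-suc i) (+-comm (a * x i) (b * y i))
  y-suc′ : ∀ i → y (suc i) ≡ d * y i + c * x i
  y-suc′ i = trans (y-suc i) (+-comm (c * x i) (d * y i))

lemma2 : (n m : ℕ) → 3 ≤ n → 2 ≤ m →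
    ((i : ℕ) →
        (Vk m n (suc i) ≡ n * Vk m n i + (m ∸ 1) * Ek m n i)
      × (Ek m n (suc i) ≡ n * Vk m n i + m * Ek m n i))
    × ((i : ℕ) →
        (Vk m n (suc (suc i)) + n * Vk m n i ≡ (n + m) * Vk m n (suc i))
      × (Ek m n (suc (suc i)) + n * Ek m n i ≡ (n + m) * Ek m n (suc i)))
lemma2 n m@(suc m′) (s≤s _) (s≤s _) =
  (λ i → Vk-suc m n i , Ek-suc m n i) ,
  cayley-hamilton n m′ n m n (Vk m n) (Ek m n) det (Vk-suc m n) (Ek-suc m n)
  where
  det : n * m ≡ m′ * n + n
  det = trans (*-suc n m′) (trans (+-comm n (n * m′)) (cong (_+ n) (*-comm n m′)))
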